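{- For integers $a,b$ with $4a^3+27b^2\neq0$ let $Y_{a,b}: y^2=x^3+ax+b$, and for an integer point $t=(x_t,y_t)\in Y_{a,b}(\mathbb Z)$ let $$Q_{a,b,t}(u,v)=u^4-6x_tu^2v^2-8y_tuv^3-(3x_t^2+4a)v^4.$$ Let $\mathrm{GL}_2(\mathbb Z)$ act on pairs $((n,m),Q(u,v))\in\mathbb Z^2\times\mathrm{Sym}^4(\mathbb Z^2)^*$ (where $u,v$ is the basis of $(\mathbb Z^2)^*$ dual to the standard basis), so that it preserves the set $\{((n,m),Q): Q(n,m)=1\}$. Then the map $$\phi:\ \{(Y_{a,b},t): t\in Y_{a,b}(\mathbb Z)\}/\{\pm1\}\longrightarrow\{((n,m),Q(u,v)): Q(n,m)=1\}/\sim,\qquad (Y_{a,b},t)\mapsto((1,0),Q_{a,b,t}),$$ is injective, where $\{\pm1\}$ acts by $t\mapsto\pm t$ (negation on the elliptic curve, i.e. $(x,y)\mapsto(x,\pm y)$) and $\sim$ is the equivalence induced by the $\mathrm{GL}_2(\mathbb Z)$-action.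
   Context: $(a,b)$ ranges over pairs of integers with $4a^3+27b^2\ne0$, and $Y_{a,b}(\mathbb Z)$ denotes the integer solutions $(x,y)$ of $y^2=x^3+ax+b$. -}

module Defs where

open import Data.Integer using (ℤ; +_; _+_; _*_; -_; _-_)
open import Data.Nat using (ℕ; zero; suc)
open import Data.List using (List; []; _∷_; map)
open import Data.Product using (_×_; _,_)
open import Data.Sum using (_⊎_)
open import Relation.Binary.PropositionalEquality using (_≡_; _≢_)

Nonsingular : ℤ → ℤ → Set
Nonsingular a b = (+ 4) * (a * a * a) + (+ 27) * (b * b) ≢ + 0

OnCurve : ℤ → ℤ → ℤ → ℤ → Set
OnCurve a b x y = y * y ≡ x * x * x + a * x + b

-- Binary forms in (u,v) as coefficient lists: for a form of degree d,
-- the i-th entry is the coefficient of u^(d-i) v^i.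
-- Products of homogeneous forms are convolutions of coefficient lists.

addP : List ℤ → List ℤ → List ℤ
addP [] ys = ys
addP xs [] = xs
addP (x ∷ xs) (y ∷ ys) = (x + y) ∷ addP xs ys

scaleP : ℤ → List ℤ → List ℤ
scaleP c = map (c *_)

mulP : List ℤ → List ℤ → List ℤ
mulP [] ys = []
mulP (x ∷ xs) ys = addP (scaleP x ys) (+ 0 ∷ mulP xs ys)

powP : List ℤ → ℕ → List ℤ
powP p zero = + 1 ∷ []
powP p (suc n) = mulP p (powP p n)

record Quartic : Set where
  constructor quartic
  field
    c0 c1 c2 c3 c4 : ℤ

coeffs : Quartic → List ℤ
coeffs (quartic c0 c1 c2 c3 c4) = c0 ∷ c1 ∷ c2 ∷ c3 ∷ c4 ∷ []

record Mat2 : Set where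
  constructor mat
  field
    p q r s : ℤ

det : Mat2 → ℤ
det (mat p q r s) = p * s - q * r

InGL2 : Mat2 → Set
InGL2 g = det g ≡ + 1 ⊎ det g ≡ - (+ 1)

applyVec : Mat2 → ℤ × ℤ → ℤ × ℤ
applyVec (mat p q r s) (n , m) = (p * n + q * m , r * n + s * m)

composeQ : Quartic → Mat2 → List ℤ
composeQ (quartic c0 c1 c2 c3 c4) (mat p q r s) =
  addP (scaleP c0 (mulP (powP L1 4) (powP L2 0)))
  (addP (scaleP c1 (mulP (powP L1 3) (powP L2 1)))
  (addP (scaleP c2 (mulP (powP L1 2) (powP L2 2)))
  (addP (scaleP c3 (mulP (powP L1 1) (powP L2 3)))
        (scaleP c4 (mulP (powP L1 0) (powP L2 4))))))
  where
  L1 = p ∷ q ∷ []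
  L2 = r ∷ s ∷ []

-- GL2(ℤ) acts by g · ((n,m), Q) = (g (n,m), Q ∘ g⁻¹); this preserves Q(n,m) = 1.
-- Two pairs are equivalent iff some g ∈ GL2(ℤ) carries one to the other:
-- ((n,m),Q) ∼ ((n',m'),Q')  iff  ∃ g ∈ GL2(ℤ), g(n,m) = (n',m') and Q = Q' ∘ g.
Equiv : (ℤ × ℤ) × Quartic → (ℤ × ℤ) × Quartic → Set
Equiv (w , Q) (w' , Q') =
  Data.Product.Σ Mat2 (λ g → InGL2 g × (applyVec g w ≡ w') × (coeffs Q ≡ composeQ Q' g))

Qabt : ℤ → ℤ → ℤ → ℤ → Quartic
Qabt a b x y = quartic (+ 1) (+ 0) (- ((+ 6) * x)) (- ((+ 8) * y))
                       (- ((+ 3) * (x * x) + (+ 4) * a))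

φ : ℤ → ℤ → ℤ → ℤ → (ℤ × ℤ) × Quartic
φ a b x y = ((+ 1 , + 0) , Qabt a b x y)

{-# OPTIONS --safe #-}
module Submission where

-- A matrix of GL₂(ℤ) fixing (1,0) is [[1,q],[0,s]] with s = ±1, and acts by
-- Q(u,v) ↦ Q(u + qv, sv).  For a monic quartic without u³v term the new u³v
-- coefficient is 4q, so q = 0 when both quartics are of the shape Q_{a,b,t}.
-- Then v ↦ sv keeps the coefficients −6x and −(3x² + 4a) and multiplies −8y by s,
-- which recovers x, a and ±y; the curve equation then recovers b.

open import Defs
open import Data.Integer using (ℤ; -_)
open import Data.Product using (_×_)
open import Data.Sum using (_⊎_)
open import Relation.Binary.PropositionalEquality using (_≡_)

open import Data.Integer using (+_; _+_; _-_; _*_; -1ℤ; NonZero)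
open import Data.Integer.Properties
  using (+-0-abelianGroup; neg-injective; *-cancelˡ-≡; *-identityˡ; -1*i≡-i)
open import Algebra.Properties.AbelianGroup +-0-abelianGroup using () renaming (∙-cancelˡ to +-cancelˡ-≡)
open import Data.Integer.Tactic.RingSolver using (solve; solve-∀)
open import Data.List using (List; []; _∷_)
open import Data.Product using (_,_; proj₁; proj₂; ∃₂)
open import Data.Sum using (inj₁; inj₂)
import Data.Sum as Sum
open import Function using (_∘′_)
open import Relation.Binary.PropositionalEquality
  using (refl; sym; trans; cong; cong₂; subst; module ≡-Reasoning)

open ≡-Reasoning

IsUnit : ℤ → Set
IsUnit s = s ≡ + 1 ⊎ s ≡ -1ℤ

unit*unit≡1 : ∀ {s} → IsUnit s → s * s ≡ + 1
unit*unit≡1 (inj₁ refl) = refl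
unit*unit≡1 (inj₂ refl) = refl

unit*i≡±i : ∀ {s} i → IsUnit s → s * i ≡ i ⊎ s * i ≡ - i
unit*i≡±i i (inj₁ refl) = inj₁ (*-identityˡ i)
unit*i≡±i i (inj₂ refl) = inj₂ (-1*i≡-i i)

[unit*i]²≡i² : ∀ {s} i → IsUnit s → (s * i) * (s * i) ≡ i * i
[unit*i]²≡i² {s} i ±1 = begin
  (s * i) * (s * i) ≡⟨ regroup s i ⟩
  (s * s) * (i * i) ≡⟨ cong (_* (i * i)) (unit*unit≡1 ±1) ⟩
  + 1 * (i * i)     ≡⟨ *-identityˡ (i * i) ⟩
  i * i             ∎
  where
  regroup : ∀ s i → (s * i) * (s * i) ≡ (s * s) * (i * i)
  regroup = solve-∀

neg-*-cancelˡ-≡ : ∀ c {i j} .{{_ : NonZero c}} → - (c * i) ≡ - (c * j) → i ≡ j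
neg-*-cancelˡ-≡ c {i} {j} = *-cancelˡ-≡ c i j ∘′ neg-injective

∷₅-injective : ∀ {A : Set} {a₀ a₁ a₂ a₃ a₄ b₀ b₁ b₂ b₃ b₄ : A} →
  a₀ ∷ a₁ ∷ a₂ ∷ a₃ ∷ a₄ ∷ [] ≡ b₀ ∷ b₁ ∷ b₂ ∷ b₃ ∷ b₄ ∷ [] →
  a₀ ≡ b₀ × a₁ ≡ b₁ × a₂ ≡ b₂ × a₃ ≡ b₃ × a₄ ≡ b₄
∷₅-injective refl = refl , refl , refl , refl , refl

fixes-e₁⇒first-column : ∀ p q r s →
  applyVec (mat p q r s) (+ 1 , + 0) ≡ (+ 1 , + 0) → p ≡ + 1 × r ≡ + 0
fixes-e₁⇒first-column p q r s e =
  trans (sym (image-e₁ p q)) (cong proj₁ e) , trans (sym (image-e₁ r s)) (cong proj₂ e)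
  where
  image-e₁ : ∀ i j → i * + 1 + j * + 0 ≡ i
  image-e₁ = solve-∀

InGL2-upper⇒IsUnit : ∀ q s → InGL2 (mat (+ 1) q (+ 0) s) → IsUnit s
InGL2-upper⇒IsUnit q s = Sum.map (trans (det-upper q s)) (trans (det-upper q s))
  where
  det-upper : ∀ q s → s ≡ + 1 * s - q * + 0
  det-upper = solve-∀

stabiliser-e₁ : ∀ Q Q' → Equiv ((+ 1 , + 0) , Q) ((+ 1 , + 0) , Q') →
  ∃₂ λ q s → IsUnit s × coeffs Q ≡ composeQ Q' (mat (+ 1) q (+ 0) s)
stabiliser-e₁ _ _ (mat p q r s , g∈GL2 , ge₁≡e₁ , Q≡Q'∘g)
  with refl , refl ← fixes-e₁⇒first-column p q r s ge₁≡e₁ =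
  q , s , InGL2-upper⇒IsUnit q s g∈GL2 , Q≡Q'∘g

composeQ-upper : ∀ c₀ c₁ c₂ c₃ c₄ q s →
  composeQ (quartic c₀ c₁ c₂ c₃ c₄) (mat (+ 1) q (+ 0) s) ≡
    c₀
    ∷ + 4 * c₀ * q + c₁ * s
    ∷ + 6 * c₀ * (q * q) + + 3 * c₁ * q * s + c₂ * (s * s)
    ∷ + 4 * c₀ * (q * q * q) + + 3 * c₁ * (q * q) * s + + 2 * c₂ * q * (s * s) + c₃ * (s * s * s)
    ∷ c₀ * (q * q * q * q) + c₁ * (q * q * q) * s + c₂ * (q * q) * (s * s) + c₃ * q * (s * s * s)
        + c₄ * (s * s * s * s)
    ∷ []
composeQ-upper c₀ c₁ c₂ c₃ c₄ q s =
  cong₂ _∷_ (solve vs) (cong₂ _∷_ (solve vs) (cong₂ _∷_ (solve vs)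
    (cong₂ _∷_ (solve vs) (cong₂ _∷_ (solve vs) refl))))
  where
  vs : List ℤ
  vs = c₀ ∷ c₁ ∷ c₂ ∷ c₃ ∷ c₄ ∷ q ∷ s ∷ []

composeQ-diagonal : ∀ c₀ c₁ c₂ c₃ c₄ s →
  composeQ (quartic c₀ c₁ c₂ c₃ c₄) (mat (+ 1) (+ 0) (+ 0) s) ≡
    c₀ ∷ s * c₁ ∷ (s * s) * c₂ ∷ (s * s) * (s * c₃) ∷ (s * s) * ((s * s) * c₄) ∷ []
composeQ-diagonal c₀ c₁ c₂ c₃ c₄ s =
  cong₂ _∷_ (solve vs) (cong₂ _∷_ (solve vs) (cong₂ _∷_ (solve vs)
    (cong₂ _∷_ (solve vs) (cong₂ _∷_ (solve vs) refl))))
  where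
  vs : List ℤ
  vs = c₀ ∷ c₁ ∷ c₂ ∷ c₃ ∷ c₄ ∷ s ∷ []

depressed : ℤ → ℤ → ℤ → Quartic
depressed = quartic (+ 1) (+ 0)

depressed-upper⇒unsheared : ∀ {c₂ c₃ c₄} c₂' c₃' c₄' q s →
  coeffs (depressed c₂ c₃ c₄) ≡ composeQ (depressed c₂' c₃' c₄') (mat (+ 1) q (+ 0) s) →
  q ≡ + 0
depressed-upper⇒unsheared c₂' c₃' c₄' q s eq =
  *-cancelˡ-≡ (+ 4) q (+ 0) (sym (trans u³v-coefficients (normalise q s)))
  where
  u³v-coefficients : + 0 ≡ + 4 * + 1 * q + + 0 * s
  u³v-coefficients = proj₁ (proj₂ (∷₅-injective (trans eq (composeQ-upper (+ 1) (+ 0) c₂' c₃' c₄' q s))))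

  normalise : ∀ q s → + 4 * + 1 * q + + 0 * s ≡ + 4 * q
  normalise = solve-∀

depressed-diagonal : ∀ {c₂ c₃ c₄} c₂' c₃' c₄' s → IsUnit s →
  coeffs (depressed c₂ c₃ c₄) ≡ composeQ (depressed c₂' c₃' c₄') (mat (+ 1) (+ 0) (+ 0) s) →
  c₂ ≡ c₂' × c₃ ≡ s * c₃' × c₄ ≡ c₄'
depressed-diagonal {c₂} {c₃} {c₄} c₂' c₃' c₄' s ±1 eq =
  trans e₂ (s²* c₂') , trans e₃ (s²* (s * c₃')) , trans e₄ (trans (s²* _) (s²* c₄'))
  where
  s²* : ∀ i → (s * s) * i ≡ i
  s²* i = trans (cong (_* i) (unit*unit≡1 ±1)) (*-identityˡ i)

  coefficients : + 1 ≡ + 1 × + 0 ≡ s * + 0 × c₂ ≡ (s * s) * c₂' × c₃ ≡ (s * s) * (s * c₃') ×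
                 c₄ ≡ (s * s) * ((s * s) * c₄')
  coefficients = ∷₅-injective (trans eq (composeQ-diagonal (+ 1) (+ 0) c₂' c₃' c₄' s))

  e₂ : c₂ ≡ (s * s) * c₂'
  e₂ = proj₁ (proj₂ (proj₂ coefficients))

  e₃ : c₃ ≡ (s * s) * (s * c₃')
  e₃ = proj₁ (proj₂ (proj₂ (proj₂ coefficients)))

  e₄ : c₄ ≡ (s * s) * ((s * s) * c₄')
  e₄ = proj₂ (proj₂ (proj₂ (proj₂ coefficients)))

depressed-upper : ∀ {c₂ c₃ c₄} c₂' c₃' c₄' q s → IsUnit s →
  coeffs (depressed c₂ c₃ c₄) ≡ composeQ (depressed c₂' c₃' c₄') (mat (+ 1) q (+ 0) s) →
  c₂ ≡ c₂' × c₃ ≡ s * c₃' × c₄ ≡ c₄'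
depressed-upper {c₂} {c₃} {c₄} c₂' c₃' c₄' q s ±1 eq =
  depressed-diagonal c₂' c₃' c₄' s ±1 (subst shear q≡0 eq)
  where
  shear : ℤ → Set
  shear q = coeffs (depressed c₂ c₃ c₄) ≡ composeQ (depressed c₂' c₃' c₄') (mat (+ 1) q (+ 0) s)
  q≡0 : q ≡ + 0
  q≡0 = depressed-upper⇒unsheared c₂' c₃' c₄' q s eq

Qabt-coefficients-injective : ∀ a x y a' x' y' s →
  - (+ 6 * x) ≡ - (+ 6 * x') ×
  - (+ 8 * y) ≡ s * - (+ 8 * y') ×
  - (+ 3 * (x * x) + + 4 * a) ≡ - (+ 3 * (x' * x') + + 4 * a') →
  x ≡ x' × y ≡ s * y' × a ≡ a'
Qabt-coefficients-injective a x y a' x' y' s (c₂≡ , c₃≡ , c₄≡) with refl ← neg-*-cancelˡ-≡ (+ 6) c₂≡ =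
  refl ,
  *-cancelˡ-≡ (+ 8) y (s * y') (neg-injective (trans c₃≡ (pull-sign s y'))) ,
  *-cancelˡ-≡ (+ 4) a a' (+-cancelˡ-≡ (+ 3 * (x * x)) (+ 4 * a) (+ 4 * a') (neg-injective c₄≡))
  where
  pull-sign : ∀ s i → s * - (+ 8 * i) ≡ - (+ 8 * (s * i))
  pull-sign = solve-∀

OnCurve-unique-b : ∀ {a a' x x'} y y' {b b'} → a ≡ a' → x ≡ x' →
  OnCurve a b x y → OnCurve a' b' x' y' → y * y ≡ y' * y' → b ≡ b'
OnCurve-unique-b {a} {x = x} y y' {b} {b'} refl refl t t' y²≡y'² =
  +-cancelˡ-≡ (x * x * x + a * x) b b' (trans (sym t) (trans y²≡y'² t'))

proposition6p1 : (a b x y a' b' x' y' : ℤ) →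
    Nonsingular a b → Nonsingular a' b' →
    OnCurve a b x y → OnCurve a' b' x' y' →
    Equiv (φ a b x y) (φ a' b' x' y') →
    a ≡ a' × b ≡ b' × x ≡ x' × (y ≡ y' ⊎ y ≡ - y')
proposition6p1 a b x y a' b' x' y' _ _ t t' e
  with q , s , ±1 , eq ← stabiliser-e₁ (Qabt a b x y) (Qabt a' b' x' y') e =
  a≡a' ,
  OnCurve-unique-b y y' a≡a' x≡x' t t' y²≡y'² ,
  x≡x' ,
  Sum.map (trans y≡sy') (trans y≡sy') (unit*i≡±i y' ±1)
  where
  recovered : x ≡ x' × y ≡ s * y' × a ≡ a'
  recovered = Qabt-coefficients-injective a x y a' x' y' s
    (depressed-upper (- (+ 6 * x')) (- (+ 8 * y')) (- (+ 3 * (x' * x') + + 4 * a')) q s ±1 eq)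

  x≡x' : x ≡ x'
  x≡x' = proj₁ recovered

  y≡sy' : y ≡ s * y'
  y≡sy' = proj₁ (proj₂ recovered)

  a≡a' : a ≡ a'
  a≡a' = proj₂ (proj₂ recovered)

  y²≡y'² : y * y ≡ y' * y'
  y²≡y'² = trans (cong (λ z → z * z) y≡sy') ([unit*i]²≡i² y' ±1)
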